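{- The problem of deciding, with an algorithm uniform on $G$, whether a finite set of edges $E\subset E(G)$ is such that $G\smallsetminus E$ has at least two infinite connected components, is $\Pi_{1}^{0}$. That is, there is an algorithm which, on input a connected and highly computable graph $G$ and a finite set of edges $E$, halts if and only if $G\smallsetminus E$ has at most one infinite connected component.
   Context: Graphs are locally finite. A graph $G$ is highly computable when $V(G)$ is a decidable subset of $\mathbb{N}$, the adjacency relation is decidable, $G$ is locally finite and the vertex degree function is computable. $G\smallsetminus E$ is the subgraph induced by $E(G)\smallsetminus E$. -}

module Defs where

open import Data.Nat using (ℕ)
open import Data.Bool using (Bool; true; false)
open import Data.List using (List; length)
open import Data.List.Membership.Propositional using (_∈_)
open import Data.List.Relation.Unary.Unique.Propositional using (Unique)
open import Data.List.Relation.Unary.All using (All)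
open import Data.Product using (Σ; _×_; _,_)
open import Relation.Nullary using (¬_)
open import Relation.Binary.PropositionalEquality using (_≡_)
open import Relation.Binary.Construct.Closure.ReflexiveTransitive using (Star)

-- A highly computable (simple, locally finite) graph, given by:
--  V   : decidable vertex set ⊆ ℕ (characteristic function)
--  Adj : decidable adjacency relation
--  deg : computable degree function
record HCGraph : Set where
  field
    V          : ℕ → Bool
    Adj        : ℕ → ℕ → Bool
    deg        : ℕ → ℕ
    adj-sym    : ∀ u v → Adj u v ≡ Adj v u
    adj-irrefl : ∀ v → Adj v v ≡ false
    adj-V      : ∀ u v → Adj u v ≡ true → V u ≡ true
    deg-spec   : ∀ v → V v ≡ true →
                 Σ (List ℕ) λ ns → Unique ns × length ns ≡ deg v ×
                   (∀ w → (w ∈ ns → Adj v w ≡ true) × (Adj v w ≡ true → w ∈ ns))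

open HCGraph public

AdjG : HCGraph → ℕ → ℕ → Set
AdjG G u v = Adj G u v ≡ true

Connected : HCGraph → Set
Connected G = ∀ u v → V G u ≡ true → V G v ≡ true → Star (AdjG G) u v

-- a finite set of edges is a list of pairs; the pair (u , v) stands for the edge {u , v}
EdgeList : Set
EdgeList = List (ℕ × ℕ)

EdgesOf : HCGraph → EdgeList → Set
EdgesOf G E = All (λ { (u , v) → AdjG G u v }) E

AdjMinus : HCGraph → EdgeList → ℕ → ℕ → Set
AdjMinus G E u v = AdjG G u v × ¬ ((u , v) ∈ E) × ¬ ((v , u) ∈ E)

Component : HCGraph → EdgeList → ℕ → ℕ → Set
Component G E u w = Star (AdjMinus G E) u w

Finite : (ℕ → Set) → Set
Finite S = Σ (List ℕ) λ xs → ∀ w → S w → w ∈ xs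

Infinite : (ℕ → Set) → Set
Infinite S = ¬ Finite S

AtMostOneInfinite : HCGraph → EdgeList → Set
AtMostOneInfinite G E =
  ∀ u v → V G u ≡ true → V G v ≡ true →
  Infinite (Component G E u) → Infinite (Component G E v) →
  Component G E u v

-- an algorithm taking a highly computable graph (via its three computable
-- functions) and a finite edge list; "A … n ≡ true" means "has halted by step n"
Algorithm : Set
Algorithm = (ℕ → Bool) → (ℕ → ℕ → Bool) → (ℕ → ℕ) → EdgeList → ℕ → Bool

Halts : Algorithm → HCGraph → EdgeList → Set
Halts A G E = Σ ℕ λ n → A (V G) (Adj G) (deg G) E n ≡ true

{-# OPTIONS --safe #-}
module Submission where

open import Defs
open import Level using (0ℓ)
open import Data.List.Relation.Unary.All using (All)
open import Data.Product using (Σ; _×_)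
open import Axiom.ExcludedMiddle using (ExcludedMiddle)

open import Function using (_∘_; id)
open import Data.Empty using (⊥-elim)
open import Data.Bool using (Bool; true)
import Data.Bool as Bool
open import Data.Nat using (ℕ; zero; suc; _<_; _≤_; _⊔_; _<?_; _≤?_; s≤s; z≤n)
open import Data.Nat.Properties using (_≟_; ≤-refl; ≤-trans; m≤m⊔n; m≤n⊔m; <⇒≱; anyUpTo?; allUpTo?)
open import Data.Product using (_,_; proj₁; proj₂; ∃-syntax; map₁; uncurry)
open import Data.Product.Properties using (≡-dec)
open import Data.Sum using (_⊎_; inj₁; inj₂)
open import Data.List using (List; []; _∷_; length; filter; downFrom)
open import Data.List.Properties using (length-removeAt′)
open import Data.List.Membership.Propositional using (_∈_; _∉_)
open import Data.List.Membership.Propositional.Properties using (∈-filter⁺; ∈-filter⁻; ∈-downFrom⁺; ∈-downFrom⁻)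
open import Data.List.Membership.DecPropositional (≡-dec _≟_ _≟_) using (_∈?_)
open import Data.List.Relation.Binary.Subset.Propositional using (_⊆_)
open import Data.List.Relation.Unary.Any using (here; there; index; _─_)
import Data.List.Relation.Unary.All as All
open import Data.List.Relation.Unary.AllPairs using (_∷_)
open import Data.List.Relation.Unary.Unique.Propositional using (Unique)
import Data.List.Relation.Unary.Unique.Propositional.Properties as Unique
open import Relation.Nullary using (Dec; yes; no; does; ¬?)
open import Relation.Nullary.Decidable using (_×-dec_; _⊎-dec_; _→-dec_; dec-true)
open import Relation.Binary.PropositionalEquality using (_≡_; _≢_; refl; sym; trans; subst; ≢-sym)
open import Relation.Binary.Construct.Closure.ReflexiveTransitive using (Star; ε; _◅_; _◅◅_; reverse)

-- As G is connected, a path of G from u to v either survives in G ∖ E or, from each end, runs in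
-- G ∖ E to an endpoint of E. Hence G ∖ E has at most one infinite component iff any two endpoints
-- a, b of E are linked: a ~ b in G ∖ E, or the component of a or of b is finite. Both alternatives
-- are semi-decidable. For a ~ b, search for paths of length ≤ n through vertices below n. The
-- component of a is finite iff for some n the vertices reached from a below n are closed under
-- G ∖ E-adjacency and each has deg x neighbours below n, i.e. all its neighbours are below n.
-- The algorithm halts at the first n certifying every pair. Its completeness is classical: excluded
-- middle decides which alternative holds, and which vertices of a finite list the component contains.

∈-─ : ∀ {a} {A : Set a} {x z : A} {ys} (x∈ys : x ∈ ys) → z ∈ ys → z ≢ x → z ∈ (ys ─ x∈ys)
∈-─ (here refl) (here refl) z≢x = ⊥-elim (z≢x refl)
∈-─ (here refl) (there z∈ys) _ = z∈ys
∈-─ (there x∈ys) (here refl) _ = here refl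
∈-─ (there x∈ys) (there z∈ys) z≢x = there (∈-─ x∈ys z∈ys z≢x)

Unique-⊆⇒length≤ : ∀ {a} {A : Set a} {xs ys : List A} → Unique xs → xs ⊆ ys → length xs ≤ length ys
Unique-⊆⇒length≤ {xs = []} _ _ = z≤n
Unique-⊆⇒length≤ {xs = x ∷ xs} {ys} (x∉xs ∷ xs!) xs⊆ys =
  subst (suc (length xs) ≤_) (sym (length-removeAt′ ys (index x∈ys)))
    (s≤s (Unique-⊆⇒length≤ xs! λ z∈xs →
      ∈-─ x∈ys (xs⊆ys (there z∈xs)) (≢-sym (All.lookup x∉xs z∈xs))))
  where x∈ys = xs⊆ys (here refl)

does≡true⇒ : ∀ {a} {A : Set a} (a? : Dec A) → does a? ≡ true → A
does≡true⇒ (yes a) _ = a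

Eventually : (ℕ → Set) → Set
Eventually P = ∃[ N ] (∀ {n} → N ≤ n → P n)

module _ {P Q : ℕ → Set} where

  eventually-map : (∀ {n} → P n → Q n) → Eventually P → Eventually Q
  eventually-map f (N , p) = N , f ∘ p

  eventually-zip : Eventually P → Eventually Q → Eventually (λ n → P n × Q n)
  eventually-zip (M , p) (N , q) =
    M ⊔ N , λ le → p (≤-trans (m≤m⊔n M N) le) , q (≤-trans (m≤n⊔m M N) le)

eventually-≥ : ∀ m → Eventually (m ≤_)
eventually-≥ m = m , id

eventually-All : {P : ℕ → ℕ → Set} {xs : List ℕ} →
                 All (λ x → Eventually (P x)) xs → Eventually (λ n → All (λ x → P x n) xs)
eventually-All All.[] = 0 , λ _ → All.[]
eventually-All (p All.∷ ps) = eventually-map (uncurry All._∷_) (eventually-zip p (eventually-All ps))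

endpoints : EdgeList → List ℕ
endpoints [] = []
endpoints ((u , v) ∷ F) = u ∷ v ∷ endpoints F

∈-endpoints-fst : ∀ {u w} F → (u , w) ∈ F → u ∈ endpoints F
∈-endpoints-fst (_ ∷ F) (here refl) = here refl
∈-endpoints-fst (_ ∷ F) (there m) = there (there (∈-endpoints-fst F m))

∈-endpoints-snd : ∀ {u w} F → (u , w) ∈ F → w ∈ endpoints F
∈-endpoints-snd (_ ∷ F) (here refl) = there (here refl)
∈-endpoints-snd (_ ∷ F) (there m) = there (there (∈-endpoints-snd F m))

module Search (Adj : ℕ → ℕ → Bool) (deg : ℕ → ℕ) (E : EdgeList) where

  -- AdjMinus G E, restated from Adj alone since that is all the algorithm receives.
  Step : ℕ → ℕ → Set
  Step u v = Adj u v ≡ true × (u , v) ∉ E × (v , u) ∉ E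

  step? : ∀ u v → Dec (Step u v)
  step? u v = Adj u v Bool.≟ true ×-dec ¬? ((u , v) ∈? E) ×-dec ¬? ((v , u) ∈? E)

  BoundedReach : ℕ → ℕ → ℕ → ℕ → Set
  BoundedReach n zero    a y = a ≡ y
  BoundedReach n (suc k) a y = BoundedReach n k a y ⊎ ∃[ z ] z < n × Step a z × BoundedReach n k z y

  boundedReach? : ∀ n k a y → Dec (BoundedReach n k a y)
  boundedReach? n zero    a y = a ≟ y
  boundedReach? n (suc k) a y =
    boundedReach? n k a y ⊎-dec anyUpTo? (λ z → step? a z ×-dec boundedReach? n k z y) n

  Reach : ℕ → ℕ → ℕ → Set
  Reach n = BoundedReach n n

  neighboursBelow : ℕ → ℕ → List ℕ
  neighboursBelow n x = filter (λ w → Adj x w Bool.≟ true) (downFrom n)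

  -- x has exactly deg x neighbours, so this says that all of them are below n.
  Saturated : ℕ → ℕ → Set
  Saturated n x = deg x ≤ length (neighboursBelow n x)

  ClosedBelow : ℕ → ℕ → Set
  ClosedBelow n a =
    a < n × (∀ {x} → x < n → Reach n a x →
             Saturated n x × (∀ {y} → y < n → Step x y → Reach n a y))

  closedBelow? : ∀ n a → Dec (ClosedBelow n a)
  closedBelow? n a = a <? n ×-dec allUpTo? (λ x →
    boundedReach? n n a x →-dec
      (deg x ≤? length (neighboursBelow n x) ×-dec
       allUpTo? (λ y → step? x y →-dec boundedReach? n n a y) n)) n

  LinkedBelow : ℕ → ℕ → ℕ → Set
  LinkedBelow n a b = Reach n a b ⊎ ClosedBelow n a ⊎ ClosedBelow n b

  Certificate : ℕ → Set
  Certificate n = All (λ a → All (LinkedBelow n a) (endpoints E)) (endpoints E)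

  certificate? : ∀ n → Dec (Certificate n)
  certificate? n = All.all? (λ a → All.all? (λ b →
    boundedReach? n n a b ⊎-dec closedBelow? n a ⊎-dec closedBelow? n b) (endpoints E)) (endpoints E)

algorithm : Algorithm
algorithm _ Adj deg E n = does (Search.certificate? Adj deg E n)

module Correctness (G : HCGraph) (E : EdgeList) where
  open Search (Adj G) (deg G) E

  Comp : ℕ → ℕ → Set
  Comp = Component G E

  V-neighbour : ∀ {x y} → Adj G x y ≡ true → V G y ≡ true
  V-neighbour {x} {y} xy = adj-V G y x (trans (adj-sym G y x) xy)

  Comp-sym : ∀ {x y} → Comp x y → Comp y x
  Comp-sym = reverse λ {x} {y} (xy , xy∉E , yx∉E) → trans (adj-sym G y x) xy , yx∉E , xy∉E

  Comp-V : ∀ {a x} → V G a ≡ true → Comp a x → V G x ≡ true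
  Comp-V va ε = va
  Comp-V _ (s ◅ p) = Comp-V (V-neighbour (proj₁ s)) p

  Finite-Comp-transfer : ∀ {u a} → Comp u a → Finite (Comp a) → Finite (Comp u)
  Finite-Comp-transfer u~a (xs , fin) = xs , λ w u~w → fin w (Comp-sym u~a ◅◅ u~w)

  boundedReach-refl : ∀ n k a → BoundedReach n k a a
  boundedReach-refl n zero    a = refl
  boundedReach-refl n (suc k) a = inj₁ (boundedReach-refl n k a)

  boundedReach-sound : ∀ {n} k {a y} → BoundedReach n k a y → Comp a y
  boundedReach-sound zero    refl = ε
  boundedReach-sound (suc k) (inj₁ r) = boundedReach-sound k r
  boundedReach-sound (suc k) (inj₂ (_ , _ , s , r)) = s ◅ boundedReach-sound k r

  reach-sound : ∀ {n a y} → Reach n a y → Comp a y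
  reach-sound {n} = boundedReach-sound n

  pathLength : ∀ {a y} → Comp a y → ℕ
  pathLength ε = 0
  pathLength (_ ◅ p) = suc (pathLength p)

  boundedReach-complete : ∀ {a y} (p : Comp a y) →
    Eventually (λ n → ∀ k → pathLength p ≤ k → BoundedReach n k a y)
  boundedReach-complete {a} ε = 0 , λ {n} _ k _ → boundedReach-refl n k a
  boundedReach-complete (_◅_ {j = z} s p) =
    eventually-map (λ { (z<n , r) (suc k) (s≤s ℓ≤k) → inj₂ (z , z<n , s , r k ℓ≤k) })
      (eventually-zip (eventually-≥ (suc z)) (boundedReach-complete p))

  reach-eventually : ∀ {a y} → Comp a y → Eventually (λ n → Reach n a y)
  reach-eventually p =
    eventually-map (λ {n} (ℓ≤n , r) → r n ℓ≤n)
      (eventually-zip (eventually-≥ (pathLength p)) (boundedReach-complete p))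

  ∈-neighboursBelow⁻ : ∀ {n x w} → w ∈ neighboursBelow n x → w < n × Adj G x w ≡ true
  ∈-neighboursBelow⁻ = map₁ ∈-downFrom⁻ ∘ ∈-filter⁻ _

  ∈-neighboursBelow⁺ : ∀ {n x w} → w < n → Adj G x w ≡ true → w ∈ neighboursBelow n x
  ∈-neighboursBelow⁺ w<n = ∈-filter⁺ _ (∈-downFrom⁺ w<n)

  neighboursBelow-unique : ∀ n x → Unique (neighboursBelow n x)
  neighboursBelow-unique n x = Unique.filter⁺ _ (Unique.downFrom⁺ n)

  saturated⇒neighbour< : ∀ {n x y} → V G x ≡ true → Saturated n x → Adj G x y ≡ true → y < n
  saturated⇒neighbour< {n} {x} {y} vx sat xy with y <? n | deg-spec G x vx
  ... | yes y<n | _ = y<n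
  ... | no y≮n | ns , ns! , ∣ns∣≡deg , spec =
    ⊥-elim (<⇒≱ (Unique-⊆⇒length≤ below! below⊆ns) (subst (_≤ _) (sym ∣ns∣≡deg) sat))
    where
    below! : Unique (y ∷ neighboursBelow n x)
    below! = All.tabulate (λ w∈ y≡w → y≮n (subst (_< n) (sym y≡w) (proj₁ (∈-neighboursBelow⁻ {n} w∈))))
             ∷ neighboursBelow-unique n x
    below⊆ns : (y ∷ neighboursBelow n x) ⊆ ns
    below⊆ns (here refl) = proj₂ (spec y) xy
    below⊆ns (there w∈) = proj₂ (spec _) (proj₂ (∈-neighboursBelow⁻ {n} w∈))

  saturated-eventually : ∀ {x} → V G x ≡ true → Eventually (λ n → Saturated n x)
  saturated-eventually {x} vx with deg-spec G x vx
  ... | ns , ns! , ∣ns∣≡deg , spec =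
    eventually-map (λ ns<n → subst (_≤ _) ∣ns∣≡deg (Unique-⊆⇒length≤ ns! λ {w} w∈ns →
                      ∈-neighboursBelow⁺ (All.lookup ns<n w∈ns) (proj₁ (spec w) w∈ns)))
      (eventually-All (All.tabulate {xs = ns} λ {w} _ → eventually-≥ (suc w)))

  closedBelow⇒bounded : ∀ {n a x y} → ClosedBelow n a →
    x < n → Reach n a x → V G x ≡ true → Comp x y → y < n
  closedBelow⇒bounded _ x<n _ _ ε = x<n
  closedBelow⇒bounded cl@(_ , closed) x<n a~x vx (s ◅ p) =
    closedBelow⇒bounded cl z<n (proj₂ (closed x<n a~x) z<n s) (V-neighbour (proj₁ s)) p
    where z<n = saturated⇒neighbour< vx (proj₁ (closed x<n a~x)) (proj₁ s)

  closedBelow⇒finite : ∀ {n a} → V G a ≡ true → ClosedBelow n a → Finite (Comp a)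
  closedBelow⇒finite {n} {a} va cl = downFrom n , λ w a~w →
    ∈-downFrom⁺ (closedBelow⇒bounded cl (proj₁ cl) (boundedReach-refl n n a) va a~w)

  finite⇒eventually-closedBelow : ExcludedMiddle 0ℓ → ∀ {a} → V G a ≡ true →
    Finite (Comp a) → Eventually (λ n → ClosedBelow n a)
  finite⇒eventually-closedBelow em {a} va (xs , fin) =
    eventually-map closes (eventually-All (All.tabulate {xs = xs} λ {x} _ → explored x))
    where
    Explored : ℕ → ℕ → Set
    Explored x n = Comp a x → x < n × Saturated n x × Reach n a x

    explored : ∀ x → Eventually (Explored x)
    explored x with em {Comp a x}
    ... | no a≁x = 0 , λ _ a~x → ⊥-elim (a≁x a~x)
    ... | yes a~x = eventually-map (λ e _ → e)
      (eventually-zip (eventually-≥ (suc x))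
        (eventually-zip (saturated-eventually (Comp-V va a~x)) (reach-eventually a~x)))

    closes : ∀ {n} → All (λ x → Explored x n) xs → ClosedBelow n a
    closes {n} all = proj₁ (explored-at ε) , λ _ a~x →
      proj₁ (proj₂ (explored-at (reach-sound a~x))) , λ _ s →
      proj₂ (proj₂ (explored-at (reach-sound a~x ◅◅ s ◅ ε)))
      where
      explored-at : ∀ {x} → Comp a x → x < n × Saturated n x × Reach n a x
      explored-at {x} a~x = All.lookup all (fin x a~x) a~x

  Linked : ℕ → ℕ → Set
  Linked a b = Comp a b ⊎ Finite (Comp a) ⊎ Finite (Comp b)

  linkedBelow⇒linked : ∀ {n a b} → V G a ≡ true → V G b ≡ true → LinkedBelow n a b → Linked a b
  linkedBelow⇒linked _  _  (inj₁ a~b) = inj₁ (reach-sound a~b)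
  linkedBelow⇒linked va _  (inj₂ (inj₁ cl)) = inj₂ (inj₁ (closedBelow⇒finite va cl))
  linkedBelow⇒linked _  vb (inj₂ (inj₂ cl)) = inj₂ (inj₂ (closedBelow⇒finite vb cl))

  linked⇒eventually-linkedBelow : ExcludedMiddle 0ℓ → ∀ {a b} → V G a ≡ true → V G b ≡ true →
    Linked a b → Eventually (λ n → LinkedBelow n a b)
  linked⇒eventually-linkedBelow _  _  _  (inj₁ a~b) = eventually-map inj₁ (reach-eventually a~b)
  linked⇒eventually-linkedBelow em va _  (inj₂ (inj₁ fin)) =
    eventually-map (inj₂ ∘ inj₁) (finite⇒eventually-closedBelow em va fin)
  linked⇒eventually-linkedBelow em _  vb (inj₂ (inj₂ fin)) =
    eventually-map (inj₂ ∘ inj₂) (finite⇒eventually-closedBelow em vb fin)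

  endpoints-V : ∀ {F} → EdgesOf G F → ∀ {a} → a ∈ endpoints F → V G a ≡ true
  endpoints-V {(u , v) ∷ _} (uv All.∷ _) (here refl) = adj-V G u v uv
  endpoints-V (uv All.∷ _) (there (here refl)) = V-neighbour uv
  endpoints-V (_ All.∷ F⊆G) (there (there a∈F)) = endpoints-V F⊆G a∈F

  stays-or-meets-E : ∀ {u v} → Star (AdjG G) u v → Comp u v ⊎ ∃[ a ] a ∈ endpoints E × Comp u a
  stays-or-meets-E ε = inj₁ ε
  stays-or-meets-E {u} (_◅_ {j = w} uw p) with (u , w) ∈? E | (w , u) ∈? E | stays-or-meets-E p
  ... | yes uw∈E | _ | _ = inj₂ (u , ∈-endpoints-fst E uw∈E , ε)
  ... | no _ | yes wu∈E | _ = inj₂ (u , ∈-endpoints-snd E wu∈E , ε)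
  ... | no uw∉E | no wu∉E | inj₁ w~v = inj₁ ((uw , uw∉E , wu∉E) ◅ w~v)
  ... | no uw∉E | no wu∉E | inj₂ (a , a∈E , w~a) = inj₂ (a , a∈E , (uw , uw∉E , wu∉E) ◅ w~a)

  endpoints-linked⇒atMostOneInfinite : Connected G →
    (∀ {a b} → a ∈ endpoints E → b ∈ endpoints E → Linked a b) → AtMostOneInfinite G E
  endpoints-linked⇒atMostOneInfinite conn linked u v vu vv u∞ v∞
    with stays-or-meets-E (conn u v vu vv) | stays-or-meets-E (conn v u vv vu)
  ... | inj₁ u~v | _ = u~v
  ... | inj₂ _ | inj₁ v~u = Comp-sym v~u
  ... | inj₂ (a , a∈E , u~a) | inj₂ (b , b∈E , v~b) with linked a∈E b∈E
  ... | inj₁ a~b = u~a ◅◅ a~b ◅◅ Comp-sym v~b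
  ... | inj₂ (inj₁ a-fin) = ⊥-elim (u∞ (Finite-Comp-transfer u~a a-fin))
  ... | inj₂ (inj₂ b-fin) = ⊥-elim (v∞ (Finite-Comp-transfer v~b b-fin))

  atMostOneInfinite⇒linked : ExcludedMiddle 0ℓ → AtMostOneInfinite G E →
    ∀ {a b} → V G a ≡ true → V G b ≡ true → Linked a b
  atMostOneInfinite⇒linked em amo {a} {b} va vb with em {Finite (Comp a)} | em {Finite (Comp b)}
  ... | yes a-fin | _ = inj₂ (inj₁ a-fin)
  ... | no _ | yes b-fin = inj₂ (inj₂ b-fin)
  ... | no a∞ | no b∞ = inj₁ (amo a b va vb a∞ b∞)

  halts⇒atMostOneInfinite : Connected G → EdgesOf G E → Halts algorithm G E → AtMostOneInfinite G E
  halts⇒atMostOneInfinite conn E⊆G (n , halted) =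
    endpoints-linked⇒atMostOneInfinite conn λ a∈E b∈E →
      linkedBelow⇒linked (endpoints-V E⊆G a∈E) (endpoints-V E⊆G b∈E)
        (All.lookup (All.lookup (does≡true⇒ (certificate? n) halted) a∈E) b∈E)

  eventually-certificate : ExcludedMiddle 0ℓ → EdgesOf G E → AtMostOneInfinite G E →
    Eventually Certificate
  eventually-certificate em E⊆G amo =
    eventually-All (All.tabulate λ a∈E → eventually-All (All.tabulate λ b∈E →
      let va = endpoints-V E⊆G a∈E
          vb = endpoints-V E⊆G b∈E
      in linked⇒eventually-linkedBelow em va vb (atMostOneInfinite⇒linked em amo va vb)))

  atMostOneInfinite⇒halts : ExcludedMiddle 0ℓ → EdgesOf G E → AtMostOneInfinite G E → Halts algorithm G E
  atMostOneInfinite⇒halts em E⊆G amo with eventually-certificate em E⊆G amo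
  ... | N , certified = N , dec-true (certificate? N) (certified ≤-refl)

corollary3p6 : Σ Algorithm λ A →
    ExcludedMiddle 0ℓ →
    ∀ (G : HCGraph) → Connected G → (E : EdgeList) → EdgesOf G E →
    (Halts A G E → AtMostOneInfinite G E) × (AtMostOneInfinite G E → Halts A G E)
corollary3p6 = algorithm , λ em G conn E E⊆G →
  Correctness.halts⇒atMostOneInfinite G E conn E⊆G , Correctness.atMostOneInfinite⇒halts G E em E⊆G
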